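{- For every connected circular arc interval hypergraph $\mathcal{H}$, $\gamma_{P_I}(\mathcal{H})=\gamma_P(\mathcal{H})=1$.
   Context: A hypergraph $\mathcal{H}=(V,E)$ has finite vertex set $V$ and edges nonempty subsets of $V$; throughout, hypergraphs are reduced (no edge is contained in another distinct edge) and have at least one edge. A circular arc interval hypergraph is a hypergraph whose vertices admit a circular order such that every edge consists of consecutive vertices in this order. A path is a sequence $v_1,e_1,v_2,\dots,e_\ell,v_{\ell+1}$ of distinct vertices and distinct edges with $v_i,v_{i+1}\in e_i$; $\mathcal{H}$ is connected if any two vertices are joined by a path. $N[a]=\bigcup_{a\in e\in E}e$, $N(a)=N[a]\setminus\{a\}$. Power domination: given $S_0\subseteq V$, first all vertices of $\bigcup_{v\in S_0}N[v]$ become observed; then repeatedly, if all unobserved neighbors of an observed vertex $v$ lie in one edge incident to $v$, they become observed. $\gamma_P(\mathcal{H})$ is the minimum size of an $S_0$ making all vertices observed. Infectious power domination: given $S_0$, set $S=\bigcup_{v\in S_0}N[v]$; then while some nonempty $A\subseteq S$ and edge $e$ satisfy $A\subseteq e$ and [every vertex $v\notin S$ such that $A\cup\{v\}$ is contained in some edge lies in $e$], add the vertices of $e$ to $S$. $\gamma_{P_I}(\mathcal{H})$ is the minimum size of an $S_0$ with $S=V$ at termination. -}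

module Defs where

open import Data.Nat using (ℕ; zero; suc; _+_; _≤_; _<_)
open import Data.Fin using (Fin; toℕ; inject₁; fromℕ)
open import Data.Fin.Subset using (Subset; _∈_; _∉_; _⊆_; _∪_; ∣_∣; ⊤; Nonempty)
open import Data.List using (List; [])
open import Data.List.Membership.Propositional using () renaming (_∈_ to _∈ₗ_)
open import Data.Product using (Σ; ∃; ∃-syntax; _×_; _,_)
open import Data.Sum using (_⊎_)
open import Relation.Binary.PropositionalEquality using (_≡_; _≢_)
open import Relation.Binary.Construct.Closure.ReflexiveTransitive using (Star)
open import Function using (Injective; _⇔_)

-- A (reduced, finite, with at least one edge) hypergraph on vertex set Fin n.
-- Edges are subsets of Fin n, listed; the edge set is the set of list entries.
record Hypergraph : Set where
  field
    n       : ℕ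
    edges   : List (Subset n)
    hasEdge : Σ (Subset n) (λ e → e ∈ₗ edges)
    edgeNonempty : ∀ {e} → e ∈ₗ edges → Nonempty e
    reduced : ∀ {e f} → e ∈ₗ edges → f ∈ₗ edges → e ⊆ f → e ≡ f

module _ (H : Hypergraph) where
  open Hypergraph H

  Vertex : Set
  Vertex = Fin n

  VSet : Set
  VSet = Subset n

  InClosedNbhd : Vertex → Vertex → Set
  InClosedNbhd v w = ∃[ e ] (e ∈ₗ edges × v ∈ e × w ∈ e)

  InOpenNbhd : Vertex → Vertex → Set
  InOpenNbhd v w = InClosedNbhd v w × w ≢ v

  record Path (a b : Vertex) : Set where
    field
      ℓ       : ℕ
      vtx     : Fin (suc ℓ) → Vertex
      edg     : Fin ℓ → Subset n
      vtxInj  : Injective _≡_ _≡_ vtx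
      edgInj  : Injective _≡_ _≡_ edg
      edgIn   : ∀ i → edg i ∈ₗ edges
      left    : ∀ i → vtx (inject₁ i) ∈ edg i
      right   : ∀ i → vtx (Fin.suc i) ∈ edg i
      start   : vtx Fin.zero ≡ a
      end     : vtx (fromℕ ℓ) ≡ b

  Connected : Set
  Connected = ∀ a b → Path a b

  -- Position p lies on the circular arc of length k starting at s in Z/n.
  InArc : Fin n → ℕ → Fin n → Set
  InArc s k p = (toℕ s ≤ toℕ p × toℕ p < toℕ s + k) ⊎ (toℕ p + n < toℕ s + k)

  -- Circular arc interval hypergraph: a circular order of the vertices
  -- (a bijection pos : V → Z/n) in which every edge is a set of consecutive vertices.
  IsCircularArcInterval : Set
  IsCircularArcInterval =
    Σ (Vertex → Fin n) λ pos → Injective _≡_ _≡_ pos ×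
      (∀ {e} → e ∈ₗ edges →
        ∃[ s ] ∃[ k ] (1 ≤ k × k ≤ n × (∀ v → (v ∈ e) ⇔ InArc s k (pos v))))

  InitialSet : VSet → VSet → Set
  InitialSet S0 S = ∀ w → (w ∈ S) ⇔ (∃[ v ] (v ∈ S0 × InClosedNbhd v w))

  PDStep : VSet → VSet → Set
  PDStep S S' =
    ∃[ v ] ∃[ e ] (v ∈ S × e ∈ₗ edges × v ∈ e ×
      (∀ w → InOpenNbhd v w → w ∉ S → w ∈ e) ×
      (∀ w → (w ∈ S') ⇔ (w ∈ S ⊎ InClosedNbhd v w)))

  PowerDominating : VSet → Set
  PowerDominating S0 = ∃[ S ] (InitialSet S0 S × Star PDStep S ⊤)

  IPDStep : VSet → VSet → Set
  IPDStep S S' =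
    ∃[ A ] ∃[ e ] (Nonempty A × A ⊆ S × e ∈ₗ edges × A ⊆ e ×
      (∀ v → v ∉ S → (∃[ f ] (f ∈ₗ edges × A ⊆ f × v ∈ f)) → v ∈ e) ×
      (∀ w → (w ∈ S') ⇔ (w ∈ S ⊎ w ∈ e)))

  InfectiousPowerDominating : VSet → Set
  InfectiousPowerDominating S0 = ∃[ S ] (InitialSet S0 S × Star IPDStep S ⊤)

  IsMinSize : (VSet → Set) → ℕ → Set
  IsMinSize P k = (∃[ S0 ] (P S0 × ∣ S0 ∣ ≡ k)) × (∀ S0 → P S0 → k ≤ ∣ S0 ∣)

  PowerDominationNumber : ℕ → Set
  PowerDominationNumber = IsMinSize PowerDominating

  InfectiousPowerDominationNumber : ℕ → Set
  InfectiousPowerDominationNumber = IsMinSize InfectiousPowerDominating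

-- Number the positions of the circular order 0, ..., n - 1 and,
-- for a start vertex v, let d u be the clockwise distance from v to u. Every
-- edge is an arc, and an arc containing a and c but skipping some b with
-- d a < d b < d c must wrap around the cycle, so it contains v and the
-- vertex at distance n - 1 (wraps-around); an edge avoiding v is therefore
-- an interval for d. We sweep: once all vertices within distance R and
-- N[v] are observed, the vertex r at distance R forces its unobserved
-- neighbours, which lie in the edge joining r to the farthest of them
-- (advance). This step is valid for both propagation rules (forcing-step).
-- The sweep cannot stall if v is chosen right after a pair of cyclically
-- consecutive non-adjacent vertices, or arbitrarily if there is no such pair
-- (here connectivity is used). So {v} dominates; and no empty set does.
module Submission where

open import Defs
open import Data.Nat
open import Data.Nat.Properties
open import Data.Nat.DivMod
open import Algebra.Properties.CommutativeSemigroup +-commutativeSemigroup using (x∙yz≈y∙xz)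
open import Data.Product using (∃; ∃-syntax; _×_; _,_; proj₁; proj₂)
open import Data.Sum using (_⊎_; inj₁; inj₂; map₂)
open import Data.Empty using (⊥; ⊥-elim)
open import Data.Fin as Fin using (Fin; toℕ; fromℕ; fromℕ<; inject₁; punchOut)
open import Data.Fin.Properties
  using (any?; punchOut-injective; injective⇒≤; toℕ<n; toℕ-injective; toℕ-fromℕ<; fromℕ<-injective)
  renaming (_≟_ to _≟ᶠ_)
open import Data.Fin.Subset using (Subset; _∈_; _∉_; ⊤; ⁅_⁆; Nonempty; ∣_∣)
open import Data.Fin.Subset.Properties
  using (_∈?_; ⊆-antisym; ∈⊤; x∈⁅x⁆; x∈⁅y⁆⇒x≡y; x∈p⇒∣p-x∣<∣p∣; ∣⁅x⁆∣≡1)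
open import Data.Vec using (tabulate)
open import Data.Vec.Properties using (lookup∘tabulate; []=⇒lookup; lookup⇒[]=)
open import Relation.Nullary using (¬_; Dec; yes; no; does)
open import Relation.Nullary.Decidable using (dec-true; map′; _×-dec_; _⊎-dec_; ¬?; decidable-stable)
open import Relation.Unary using (Decidable)
open import Relation.Binary.PropositionalEquality
open import Function using (_∘_; _⇔_; mk⇔; Injective; Equivalence)
open import Data.List.Membership.Propositional using (find; lose) renaming (_∈_ to _∈ₗ_)
import Data.List.Relation.Unary.Any as Any
open import Function.Construct.Composition using (_⇔-∘_)
open import Relation.Binary.Construct.Closure.ReflexiveTransitive as Star using (Star; ε; _◅_; _◅◅_)

-- Clockwise distances on the cycle ℤ/n, with positions represented by
-- natural numbers below n.
module Clockwise (n : ℕ) {{_ : NonZero n}} where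

  dist : ℕ → ℕ → ℕ
  dist s p = (p + (n ∸ s)) % n

  dist<n : ∀ s p → dist s p < n
  dist<n s p = m%n<n (p + (n ∸ s)) n

  %-once : ∀ {m} → n ≤ m → m < n + n → m % n ≡ m ∸ n
  %-once {m} n≤m m<2n = begin
    m % n       ≡⟨ m≤n⇒[n∸m]%m≡n%m n≤m ⟨
    (m ∸ n) % n ≡⟨ m<n⇒m%n≡m (subst (m ∸ n <_) (m+n∸m≡n n n) (∸-monoˡ-< m<2n n≤m)) ⟩
    m ∸ n       ∎
    where open ≡-Reasoning

  dist-forward : ∀ {s p} → s ≤ p → p < n → dist s p ≡ p ∸ s
  dist-forward {s} {p} s≤p p<n = begin
    (p + (n ∸ s)) % n ≡⟨ cong (_% n) (+-∸-assoc p (≤-trans s≤p (<⇒≤ p<n))) ⟨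
    (p + n ∸ s) % n   ≡⟨ cong (_% n) (+-∸-comm n s≤p) ⟩
    (p ∸ s + n) % n   ≡⟨ [m+n]%n≡m%n (p ∸ s) n ⟩
    (p ∸ s) % n       ≡⟨ m<n⇒m%n≡m (≤-<-trans (m∸n≤m p s) p<n) ⟩
    p ∸ s             ∎
    where open ≡-Reasoning

  dist-backward : ∀ {s p} → p < s → s < n → dist s p ≡ p + (n ∸ s)
  dist-backward {s} {p} p<s s<n = m<n⇒m%n≡m (begin-strict
    p + (n ∸ s) <⟨ +-monoˡ-< (n ∸ s) p<s ⟩
    s + (n ∸ s) ≡⟨ m+[n∸m]≡n (<⇒≤ s<n) ⟩
    n           ∎)
    where open ≤-Reasoning

  dist-self : ∀ {s} → s ≤ n → dist s s ≡ 0
  dist-self {s} s≤n = trans (cong (_% n) (m+[n∸m]≡n s≤n)) (n%n≡0 n)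

  dist-via : ∀ {v} s p → v ≤ n → dist s p ≡ (dist v p + dist s v) % n
  dist-via {v} s p v≤n = begin
    (p + (n ∸ s)) % n                             ≡⟨ [m+n]%n≡m%n (p + (n ∸ s)) n ⟨
    (p + (n ∸ s) + n) % n                         ≡⟨ cong (_% n) regroup ⟩
    (p + (n ∸ v) + (v + (n ∸ s))) % n             ≡⟨ %-distribˡ-+ (p + (n ∸ v)) (v + (n ∸ s)) n ⟩
    ((p + (n ∸ v)) % n + (v + (n ∸ s)) % n) % n  ∎
    where
    open ≡-Reasoning
    regroup : p + (n ∸ s) + n ≡ p + (n ∸ v) + (v + (n ∸ s))
    regroup = begin
      p + (n ∸ s) + n               ≡⟨ +-assoc p (n ∸ s) n ⟩
      p + ((n ∸ s) + n)             ≡⟨ cong (p +_) (+-comm (n ∸ s) n) ⟩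
      p + (n + (n ∸ s))             ≡⟨ cong (λ t → p + (t + (n ∸ s))) (m∸n+n≡m v≤n) ⟨
      p + ((n ∸ v) + v + (n ∸ s))   ≡⟨ cong (p +_) (+-assoc (n ∸ v) v (n ∸ s)) ⟩
      p + ((n ∸ v) + (v + (n ∸ s))) ≡⟨ +-assoc p (n ∸ v) (v + (n ∸ s)) ⟨
      p + (n ∸ v) + (v + (n ∸ s))   ∎

  dist≡0⇒≡ : ∀ {p q} → p < n → q < n → dist p q ≡ 0 → p ≡ q
  dist≡0⇒≡ {p} {q} p<n q<n d≡0 with p ≤? q
  ... | yes p≤q = ≤-antisym p≤q (m∸n≡0⇒m≤n (trans (sym (dist-forward p≤q q<n)) d≡0))
  ... | no p≰q  = ⊥-elim (<⇒≱ p<n (m∸n≡0⇒m≤n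
                    (m+n≡0⇒n≡0 q (trans (sym (dist-backward (≰⇒> p≰q) p<n)) d≡0))))

  dist-injective : ∀ {s p q} → s ≤ n → p < n → q < n → dist s p ≡ dist s q → p ≡ q
  dist-injective {s} {p} {q} s≤n p<n q<n eq = dist≡0⇒≡ p<n q<n (begin
    dist p q                   ≡⟨ dist-via p q s≤n ⟩
    (dist s q + dist p s) % n  ≡⟨ cong (λ t → (t + dist p s) % n) eq ⟨
    (dist s p + dist p s) % n  ≡⟨ dist-via p p s≤n ⟨
    dist p p                   ≡⟨ dist-self (<⇒≤ p<n) ⟩
    0                          ∎)
    where open ≡-Reasoning

  suc-%≡0 : ∀ m → suc m % n ≡ 0 → m % n ≡ n ∸ 1
  suc-%≡0 m eq with suc (m % n) <? n
  ... | yes lt = ⊥-elim (1+n≢0 (trans (sym (m<n⇒m%n≡m lt)) (trans (sym suc-%) eq)))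
    where
    suc-% : suc m % n ≡ suc (m % n) % n
    suc-% = trans (cong (λ t → suc t % n) (m≡m%n+[m/n]*n m n)) ([m+kn]%n≡m%n (suc (m % n)) (m / n) n)
  ... | no ¬lt = cong (_∸ 1) (≤-antisym (m%n<n m n) (≮⇒≥ ¬lt))

  dist-predecessor : ∀ {s p q R} → s ≤ n → q ≤ n →
                     dist s p ≡ R → dist s q ≡ suc R → dist q p ≡ n ∸ 1
  dist-predecessor {s} {p} {q} {R} s≤n q≤n sp≡R sq≡1+R =
    trans (dist-via q p s≤n) (trans (cong (λ t → (t + dist q s) % n) sp≡R) (suc-%≡0 (R + dist q s) wraps))
    where
    wraps : suc (R + dist q s) % n ≡ 0
    wraps = begin
      (suc R + dist q s) % n    ≡⟨ cong (λ t → (t + dist q s) % n) sq≡1+R ⟨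
      (dist s q + dist q s) % n ≡⟨ dist-via q q s≤n ⟨
      dist q q                  ≡⟨ dist-self q≤n ⟩
      0                         ∎
      where open ≡-Reasoning

  inArc⇔dist< : ∀ {s k p} → s < n → k ≤ n → p < n →
                ((s ≤ p × p < s + k) ⊎ (p + n < s + k)) ⇔ dist s p < k
  inArc⇔dist< {s} {k} {p} s<n k≤n p<n = mk⇔ to from
    where
    open ≤-Reasoning
    to : ((s ≤ p × p < s + k) ⊎ (p + n < s + k)) → dist s p < k
    to (inj₁ (s≤p , p<s+k)) = begin-strict
      dist s p ≡⟨ dist-forward s≤p p<n ⟩
      p ∸ s    <⟨ ∸-monoˡ-< p<s+k s≤p ⟩
      s + k ∸ s ≡⟨ m+n∸m≡n s k ⟩
      k        ∎
    to (inj₂ p+n<s+k) with s ≤? p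
    ... | yes s≤p = ⊥-elim (<-irrefl refl (<-≤-trans p+n<s+k (+-mono-≤ s≤p k≤n)))
    ... | no s≰p  = begin-strict
      dist s p    ≡⟨ dist-backward (≰⇒> s≰p) s<n ⟩
      p + (n ∸ s) ≡⟨ +-∸-assoc p (<⇒≤ s<n) ⟨
      p + n ∸ s   <⟨ ∸-monoˡ-< p+n<s+k (≤-trans (<⇒≤ s<n) (m≤n+m n p)) ⟩
      s + k ∸ s   ≡⟨ m+n∸m≡n s k ⟩
      k           ∎
    from : dist s p < k → ((s ≤ p × p < s + k) ⊎ (p + n < s + k))
    from d<k with s ≤? p
    ... | yes s≤p = inj₁ (s≤p , (begin-strict
      p           ≡⟨ m+[n∸m]≡n s≤p ⟨
      s + (p ∸ s) <⟨ +-monoʳ-< s (subst (_< k) (dist-forward s≤p p<n) d<k) ⟩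
      s + k       ∎))
    ... | no s≰p = inj₂ (begin-strict
      p + n             ≡⟨ cong (p +_) (m+[n∸m]≡n (<⇒≤ s<n)) ⟨
      p + (s + (n ∸ s)) ≡⟨ x∙yz≈y∙xz p s (n ∸ s) ⟩
      s + (p + (n ∸ s)) <⟨ +-monoʳ-< s (subst (_< k) (dist-backward (≰⇒> s≰p) s<n) d<k) ⟩
      s + k             ∎)

  rotate-< : ∀ {c z y} → z < y → y < n → c < n → (n ≤ z + c ⊎ y + c < n) →
             (z + c) % n < (y + c) % n
  rotate-< {c} {z} {y} z<y y<n c<n (inj₂ y+c<n) = begin-strict
    (z + c) % n ≡⟨ m<n⇒m%n≡m (<-trans (+-monoˡ-< c z<y) y+c<n) ⟩
    z + c       <⟨ +-monoˡ-< c z<y ⟩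
    y + c       ≡⟨ m<n⇒m%n≡m y+c<n ⟨
    (y + c) % n ∎
    where open ≤-Reasoning
  rotate-< {c} {z} {y} z<y y<n c<n (inj₁ n≤z+c) = begin-strict
    (z + c) % n ≡⟨ %-once n≤z+c (<-trans z+c<y+c y+c<2n) ⟩
    z + c ∸ n   <⟨ ∸-monoˡ-< z+c<y+c n≤z+c ⟩
    y + c ∸ n   ≡⟨ %-once (≤-trans n≤z+c (<⇒≤ z+c<y+c)) y+c<2n ⟨
    (y + c) % n ∎
    where
    open ≤-Reasoning
    z+c<y+c : z + c < y + c
    z+c<y+c = +-monoˡ-< c z<y
    y+c<2n : y + c < n + n
    y+c<2n = +-mono-< y<n c<n

  last-rotated : ∀ {c} → 0 < c → c < n → ((n ∸ 1) + c) % n < c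
  last-rotated {suc c} _ 1+c<n = begin-strict
    ((n ∸ 1) + suc c) % n ≡⟨ cong (_% n) shift ⟩
    (c + n) % n           ≡⟨ [m+n]%n≡m%n c n ⟩
    c % n                 ≡⟨ m<n⇒m%n≡m (<-trans (n<1+n c) 1+c<n) ⟩
    c                     <⟨ n<1+n c ⟩
    suc c                 ∎
    where
    open ≤-Reasoning
    shift : (n ∸ 1) + suc c ≡ c + n
    shift = begin-equality
      (n ∸ 1) + suc c ≡⟨ +-suc (n ∸ 1) c ⟩
      suc (n ∸ 1) + c ≡⟨ cong (_+ c) (m+[n∸m]≡n (>-nonZero⁻¹ n)) ⟩
      n + c           ≡⟨ +-comm n c ⟩
      c + n           ∎

  skip-wraps : ∀ {c x z y k} → c < n → x < z → z < y → y < n →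
               (x + c) % n < k → (y + c) % n < k → ¬ ((z + c) % n < k) →
               c < k × ((n ∸ 1) + c) % n < k
  skip-wraps {c} {x} {z} {y} {k} c<n x<z z<y y<n x∈ y∈ z∉ = start∈ , last∈
    where
    -- Since z falls outside, the rotation must separate z from y.
    order-kept : n ≤ z + c ⊎ y + c < n → ⊥
    order-kept h = z∉ (<-trans (rotate-< z<y y<n c<n h) y∈)
    start∈ : c < k
    start∈ with x + c <? n
    ... | yes x+c<n = ≤-<-trans (m≤n+m c x) (subst (_< k) (m<n⇒m%n≡m x+c<n) x∈)
    ... | no x+c≮n  = ⊥-elim (order-kept (inj₁ (≤-trans (≮⇒≥ x+c≮n) (+-monoˡ-≤ c (<⇒≤ x<z)))))
    last∈ : ((n ∸ 1) + c) % n < k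
    last∈ with 0 <? c
    ... | yes 0<c = <-trans (last-rotated 0<c c<n) start∈
    ... | no 0≮c  = ⊥-elim (order-kept (inj₂ (subst (λ t → y + t < n) (sym c≡0) y+0<n)))
      where
      c≡0 : c ≡ 0
      c≡0 = n≤0⇒n≡0 (≮⇒≥ 0≮c)
      y+0<n : y + 0 < n
      y+0<n = subst (_< n) (sym (+-identityʳ y)) y<n

injective⇒surjective : ∀ {m} (f : Fin m → Fin m) → Injective _≡_ _≡_ f →
                       ∀ t → ∃ λ u → f u ≡ t
injective⇒surjective {suc m} f f-inj t with any? (λ u → f u ≟ᶠ t)
... | yes hit = hit
... | no miss  = ⊥-elim (1+n≰n (injective⇒≤ g-inj))
  where
  -- Missing t, f would squeeze Fin (1 + m) injectively into Fin m.
  g : Fin (suc m) → Fin m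
  g u = punchOut {i = t} (λ t≡fu → miss (u , sym t≡fu))
  g-inj : Injective _≡_ _≡_ g
  g-inj {a} {b} eq = f-inj (punchOut-injective (λ e → miss (a , sym e)) (λ e → miss (b , sym e)) eq)

maximiser : ∀ {m} {Q : Fin m → Set} → Decidable Q → (f : Fin m → ℕ) →
            (∀ u → ¬ Q u) ⊎ (∃ λ u → Q u × (∀ u′ → Q u′ → f u′ ≤ f u))
maximiser {zero} Q? f = inj₁ (λ ())
maximiser {suc m} Q? f with maximiser (λ u → Q? (Fin.suc u)) (λ u → f (Fin.suc u)) | Q? Fin.zero
... | inj₁ none         | no ¬q₀ = inj₁ λ { Fin.zero → ¬q₀ ; (Fin.suc u) → none u }
... | inj₁ none         | yes q₀ = inj₂ (Fin.zero , q₀ , λ { Fin.zero _ → ≤-refl ; (Fin.suc u) q → ⊥-elim (none u q) })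
... | inj₂ (u , q , max) | no ¬q₀ = inj₂ (Fin.suc u , q , λ { Fin.zero q₀ → ⊥-elim (¬q₀ q₀) ; (Fin.suc u′) q′ → max u′ q′ })
... | inj₂ (u , q , max) | yes q₀ with f Fin.zero ≤? f (Fin.suc u)
...   | yes le = inj₂ (Fin.suc u , q , λ { Fin.zero _ → le ; (Fin.suc u′) q′ → max u′ q′ })
...   | no nle = inj₂ (Fin.zero , q₀ , λ { Fin.zero _ → ≤-refl
                                        ; (Fin.suc u′) q′ → ≤-trans (max u′ q′) (<⇒≤ (≰⇒> nle)) })

leaves : ∀ {m ℓ} (S : Subset m) (f : Fin (suc ℓ) → Fin m) → f Fin.zero ∈ S → f (fromℕ ℓ) ∉ S →
         ∃ λ i → f (inject₁ i) ∈ S × f (Fin.suc i) ∉ S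
leaves {ℓ = zero}  S f first∈ last∉ = ⊥-elim (last∉ first∈)
leaves {ℓ = suc ℓ} S f first∈ last∉ with f (Fin.suc Fin.zero) ∈? S
... | no second∉ = Fin.zero , first∈ , second∉
... | yes second∈ with leaves S (λ i → f (Fin.suc i)) second∈ last∉
...   | i , inside , outside = Fin.suc i , inside , outside

subset : ∀ {m} {P : Fin m → Set} → Decidable P → Subset m
subset P? = tabulate (λ i → does (P? i))

∈-subset : ∀ {m} {P : Fin m → Set} (P? : Decidable P) i → i ∈ subset P? ⇔ P i
∈-subset P? i = mk⇔ to (λ p → lookup⇒[]= i _ (trans (lookup∘tabulate _ i) (dec-true (P? i) p)))
  where
  to : i ∈ subset P? → _
  to i∈ with P? i | trans (sym (lookup∘tabulate (λ j → does (P? j)) i)) ([]=⇒lookup i∈)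
  ... | yes p | _ = p

module _ (H : Hypergraph) where
  open Hypergraph H

  JointStep : VSet H → VSet H → Set
  JointStep S S′ = PDStep H S S′ × IPDStep H S S′

  -- If all unobserved neighbours of an observed vertex r lie in one edge
  -- e ∋ r, then observing e is at the same time a power-domination step
  -- (the new set S ∪ e equals S ∪ N[r]) and an infectious step with A = {r}.

  forcing-step : ∀ {S S′ r e} → r ∈ S → e ∈ₗ edges → r ∈ e →
                 (∀ w → InClosedNbhd H r w → w ∉ S → w ∈ e) →
                 (∀ w → (w ∈ S′) ⇔ (w ∈ S ⊎ w ∈ e)) →
                 JointStep S S′
  forcing-step {S} {S′} {r} {e} r∈S e∈ r∈e forced S′≡S∪e =
      (r , e , r∈S , e∈ , r∈e , (λ w nb w∉ → forced w (proj₁ nb) w∉) , λ w → mk⇔ (to w) (from w))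
    , (⁅ r ⁆ , e , (r , x∈⁅x⁆ r) , ⁅r⁆⊆ r∈S , e∈ , ⁅r⁆⊆ r∈e
      , (λ w w∉ (f , f∈ , r∈f , w∈f) → forced w (f , f∈ , r∈f (x∈⁅x⁆ r) , w∈f) w∉) , S′≡S∪e)
    where
    ⁅r⁆⊆ : ∀ {X : Subset n} → r ∈ X → ∀ {x} → x ∈ ⁅ r ⁆ → x ∈ X
    ⁅r⁆⊆ {X} r∈X x∈ = subst (_∈ X) (sym (x∈⁅y⁆⇒x≡y r x∈)) r∈X
    to : ∀ w → w ∈ S′ → w ∈ S ⊎ InClosedNbhd H r w
    to w w∈ = map₂ (λ w∈e → e , e∈ , r∈e , w∈e) (Equivalence.to (S′≡S∪e w) w∈)
    from : ∀ w → w ∈ S ⊎ InClosedNbhd H r w → w ∈ S′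
    from w (inj₁ w∈S) = Equivalence.from (S′≡S∪e w) (inj₁ w∈S)
    from w (inj₂ nb) with w ∈? S
    ... | yes w∈S = Equivalence.from (S′≡S∪e w) (inj₁ w∈S)
    ... | no w∉S  = Equivalence.from (S′≡S∪e w) (inj₂ (forced w nb w∉S))

  initial-nonempty : ∀ {Step : VSet H → VSet H → Set} → Vertex H →
                     (∀ {S S′} → Step S S′ → Nonempty S) →
                     ∀ S₀ → ∃[ S ] (InitialSet H S₀ S × Star Step S ⊤) → 1 ≤ ∣ S₀ ∣
  initial-nonempty {Step} x₀ step-nonempty S₀ (S , init , steps) =
    let w , w∈S = observed steps
        v , v∈S₀ , _ = Equivalence.to (init w) w∈S
    in ≤-<-trans z≤n (x∈p⇒∣p-x∣<∣p∣ v∈S₀)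
    where
    observed : ∀ {S} → Star Step S ⊤ → Nonempty S
    observed ε        = x₀ , ∈⊤
    observed (s ◅ _) = step-nonempty s

module CircularArc (H : Hypergraph) (connected : Connected H) (circular : IsCircularArcInterval H)
                   {{_ : NonZero (Hypergraph.n H)}} where
  open Hypergraph H
  open Clockwise n

  pos : Vertex H → ℕ
  pos u = toℕ (proj₁ circular u)

  pos<n : ∀ u → pos u < n
  pos<n u = toℕ<n (proj₁ circular u)

  pos-injective : ∀ {a b} → pos a ≡ pos b → a ≡ b
  pos-injective eq = proj₁ (proj₂ circular) (toℕ-injective eq)

  Adj : Vertex H → Vertex H → Set
  Adj = InClosedNbhd H

  adj? : ∀ u w → Dec (Adj u w)
  adj? u w = map′ find (λ (e , e∈ , both) → lose e∈ both) (Any.any? (λ e → (u ∈? e) ×-dec (w ∈? e)) edges)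

  -- Every vertex lies in an edge: on a path from it to a vertex of some
  -- edge, it is either that vertex or lies in the first edge of the path.
  adj-self : ∀ u → Adj u u
  adj-self u with hasEdge
  ... | e₀ , e₀∈ with edgeNonempty e₀∈
  ...   | x , x∈e₀ with connected u x
  ...     | record { ℓ = zero ; start = start ; end = end } =
              e₀ , e₀∈ , u∈e₀ , u∈e₀
    where
    u∈e₀ : u ∈ e₀
    u∈e₀ = subst (_∈ e₀) (trans (sym end) start) x∈e₀
  ...     | record { ℓ = suc _ ; edg = edg ; edgIn = edgIn ; left = left ; start = start } =
              edg Fin.zero , edgIn Fin.zero , u∈ , u∈
    where
    u∈ : u ∈ edg Fin.zero
    u∈ = subst (_∈ edg Fin.zero) start (left Fin.zero)

  record Arc (e : Subset n) : Set where
    field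
      start length : ℕ
      member⇔ : ∀ u → u ∈ e ⇔ dist start (pos u) < length

  arc : ∀ {e} → e ∈ₗ edges → Arc e
  arc e∈ with proj₂ (proj₂ circular) e∈
  ... | s , k , _ , k≤n , iff = record
    { start = toℕ s ; length = k
    ; member⇔ = λ u → inArc⇔dist< (toℕ<n s) k≤n (pos<n u) ⇔-∘ iff u }

  module Sweep (v : Vertex H) where

    d : Vertex H → ℕ
    d u = dist (pos v) (pos u)

    d<n : ∀ u → d u < n
    d<n u = dist<n (pos v) (pos u)

    d-injective : ∀ {a b} → d a ≡ d b → a ≡ b
    d-injective eq = pos-injective (dist-injective (<⇒≤ (pos<n v)) (pos<n _) (pos<n _) eq)

    d-self : d v ≡ 0
    d-self = dist-self (<⇒≤ (pos<n v))

    -- Every distance below n is attained, as d is injective on n vertices.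
    d-onto : ∀ t → t < n → ∃ λ u → d u ≡ t
    d-onto t t<n with injective⇒surjective (λ u → fromℕ< (d<n u))
                        (λ eq → d-injective (fromℕ<-injective _ _ (d<n _) (d<n _) eq)) (fromℕ< t<n)
    ... | u , eq = u , trans (sym (toℕ-fromℕ< (d<n u))) (trans (cong toℕ eq) (toℕ-fromℕ< t<n))

    wraps-around : ∀ {e a b c} → e ∈ₗ edges → a ∈ e → c ∈ e → b ∉ e → d a < d b → d b < d c →
                   v ∈ e × (∀ u → d u ≡ n ∸ 1 → u ∈ e)
    wraps-around {e} {a} {b} {c} e∈ a∈ c∈ b∉ a<b b<c =
        Equivalence.from (in-arc v) (subst (_< length) (sym v-coordinate) shift<length)
      , λ u du → Equivalence.from (in-arc u) (subst (λ t → (t + shift) % n < length) (sym du) last<length)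
      where
      open Arc (arc e∈)
      shift : ℕ
      shift = dist start (pos v)
      in-arc : ∀ u → u ∈ e ⇔ (d u + shift) % n < length
      in-arc u = subst (λ t → u ∈ e ⇔ t < length) (dist-via start (pos u) (<⇒≤ (pos<n v))) (member⇔ u)
      v-coordinate : (d v + shift) % n ≡ shift
      v-coordinate = trans (cong (λ t → (t + shift) % n) d-self) (m<n⇒m%n≡m (dist<n start (pos v)))
      wrapped : shift < length × ((n ∸ 1) + shift) % n < length
      wrapped = skip-wraps (dist<n start (pos v)) a<b b<c (d<n c)
                  (Equivalence.to (in-arc a) a∈) (Equivalence.to (in-arc c) c∈)
                  (λ b-inside → b∉ (Equivalence.from (in-arc b) b-inside))
      shift<length : shift < length
      shift<length = proj₁ wrapped
      last<length : ((n ∸ 1) + shift) % n < length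
      last<length = proj₂ wrapped

    convex : ∀ {e a b c} → e ∈ₗ edges → v ∉ e → a ∈ e → c ∈ e → d a ≤ d b → d b ≤ d c → b ∈ e
    convex {e} {a} {b} {c} e∈ v∉e a∈ c∈ a≤b b≤c with d a ≟ d b | d b ≟ d c | b ∈? e
    ... | yes a≡b | _       | _     = subst (_∈ e) (d-injective a≡b) a∈
    ... | no _    | yes b≡c | _     = subst (_∈ e) (d-injective (sym b≡c)) c∈
    ... | no _    | no _    | yes b∈ = b∈
    ... | no a≢b  | no b≢c  | no b∉ =
      ⊥-elim (v∉e (proj₁ (wraps-around e∈ a∈ c∈ b∉ (≤∧≢⇒< a≤b a≢b) (≤∧≢⇒< b≤c b≢c))))

    -- Once the sweep has reached distance R, the observed vertices are those
    -- within distance R together with the closed neighbourhood N[v].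
    Obs : ℕ → Subset n
    Obs R = subset (λ u → (d u ≤? R) ⊎-dec adj? v u)

    obs⇔ : ∀ {R} u → u ∈ Obs R ⇔ (d u ≤ R ⊎ Adj v u)
    obs⇔ {R} u = ∈-subset (λ u → (d u ≤? R) ⊎-dec adj? v u) u

    within : ∀ {R u} → d u ≤ R → u ∈ Obs R
    within le = Equivalence.from (obs⇔ _) (inj₁ le)

    near : ∀ {R u} → Adj v u → u ∈ Obs R
    near adj = Equivalence.from (obs⇔ _) (inj₂ adj)

    beyond : ∀ {R u} → u ∉ Obs R → R < d u
    beyond u∉ = ≰⇒> (λ le → u∉ (within le))

    far : ∀ {R u} → u ∉ Obs R → ¬ Adj v u
    far u∉ adj = u∉ (near adj)

    obs-mono : ∀ {R R′ u} → R ≤ R′ → u ∈ Obs R → u ∈ Obs R′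
    obs-mono R≤R′ u∈ with Equivalence.to (obs⇔ _) u∈
    ... | inj₁ le  = within (≤-trans le R≤R′)
    ... | inj₂ adj = near adj

    unobserved-next : ∀ {R w} → d w ≡ suc R → ¬ Adj v w → w ∉ Obs R
    unobserved-next dw ¬adj w∈ with Equivalence.to (obs⇔ _) w∈
    ... | inj₁ le  = 1+n≰n (subst (_≤ _) dw le)
    ... | inj₂ adj = ¬adj adj

    initially : InitialSet H ⁅ v ⁆ (Obs 0)
    initially w = mk⇔ to from
      where
      to : w ∈ Obs 0 → ∃[ v′ ] (v′ ∈ ⁅ v ⁆ × Adj v′ w)
      to w∈ with Equivalence.to (obs⇔ w) w∈
      ... | inj₁ d≤0 = v , x∈⁅x⁆ v , subst (Adj v) (d-injective (trans d-self (sym (n≤0⇒n≡0 d≤0)))) (adj-self v)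
      ... | inj₂ adj = v , x∈⁅x⁆ v , adj
      from : ∃[ v′ ] (v′ ∈ ⁅ v ⁆ × Adj v′ w) → w ∈ Obs 0
      from (v′ , v′∈ , adj) = near (subst (λ x → Adj x w) (x∈⁅y⁆⇒x≡y v v′∈) adj)

    obs-full : ∀ {R} → n ≤ suc R → Obs R ≡ ⊤
    obs-full n≤1+R = ⊆-antisym (λ _ → ∈⊤) (λ {u} _ → within (≤-pred (≤-trans (d<n u) n≤1+R)))

    obs-skip : ∀ {R w} → d w ≡ suc R → Adj v w → Obs R ≡ Obs (suc R)
    obs-skip {R} {w} dw adj = ⊆-antisym (obs-mono (n≤1+n R)) extend
      where
      extend : ∀ {u} → u ∈ Obs (suc R) → u ∈ Obs R
      extend {u} u∈ with Equivalence.to (obs⇔ u) u∈ | d u ≟ suc R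
      ... | inj₂ adj′ | _       = near adj′
      ... | inj₁ _    | yes du  = near (subst (Adj v) (d-injective (trans dw (sym du))) adj)
      ... | inj₁ le   | no du≢ = within (≤-pred (≤∧≢⇒< le du≢))

    -- The sweep step: r at distance R is observed, and u⁺ is its unobserved
    -- neighbour farthest from v, joined to r by the edge e. As e cannot
    -- contain v, it contains all unobserved neighbours of r, and observing
    -- e extends the observed region up to distance d u⁺.
    advance : ∀ {R r u⁺ e} → d r ≡ R → e ∈ₗ edges → r ∈ e → u⁺ ∈ e → u⁺ ∉ Obs R →
              (∀ u → Adj r u → u ∉ Obs R → d u ≤ d u⁺) → JointStep H (Obs R) (Obs (d u⁺))
    advance {R} {r} {u⁺} {e} dr e∈ r∈e u⁺∈e u⁺∉ farthest =
      forcing-step H (within (≤-reflexive dr)) e∈ r∈e forced grown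
      where
      v∉e : v ∉ e
      v∉e v∈e = far u⁺∉ (e , e∈ , v∈e , u⁺∈e)
      between : ∀ u → u ∉ Obs R → d u ≤ d u⁺ → u ∈ e
      between u u∉ le = convex e∈ v∉e r∈e u⁺∈e (subst (_≤ d u) (sym dr) (<⇒≤ (beyond u∉))) le
      forced : ∀ u → Adj r u → u ∉ Obs R → u ∈ e
      forced u adj u∉ = between u u∉ (farthest u adj u∉)
      grown : ∀ u → u ∈ Obs (d u⁺) ⇔ (u ∈ Obs R ⊎ u ∈ e)
      grown u = mk⇔ to from
        where
        to : u ∈ Obs (d u⁺) → u ∈ Obs R ⊎ u ∈ e
        to u∈ with u ∈? Obs R | Equivalence.to (obs⇔ u) u∈
        ... | yes u∈R | _        = inj₁ u∈R
        ... | no u∉R  | inj₁ le  = inj₂ (between u u∉R le)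
        ... | no u∉R  | inj₂ adj = ⊥-elim (far u∉R adj)
        from : u ∈ Obs R ⊎ u ∈ e → u ∈ Obs (d u⁺)
        from (inj₁ u∈R) = obs-mono (<⇒≤ (beyond u⁺∉)) u∈R
        from (inj₂ u∈e) with u ∈? Obs R
        ... | yes u∈R = obs-mono (<⇒≤ (beyond u⁺∉)) u∈R
        ... | no u∉R  = within (farthest u (e , e∈ , r∈e , u∈e) u∉R)

    NeverStuck : Set
    NeverStuck = ∀ {R r w} → d r ≡ R → d w ≡ suc R → suc R < n → ¬ Adj v w →
                 ¬ (∀ u → Adj r u → u ∈ Obs R)

    progress : NeverStuck → ∀ {R} → suc R < n →
               ∃ λ R′ → R < R′ × Star (JointStep H) (Obs R) (Obs R′)
    progress never-stuck {R} more with d-onto R (<-trans (n<1+n R) more) | d-onto (suc R) more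
    ... | r , dr | w , dw with adj? v w
    ...   | yes adj = suc R , n<1+n R , subst (Star _ (Obs R)) (obs-skip dw adj) ε
    ...   | no ¬adj with maximiser (λ u → adj? r u ×-dec ¬? (u ∈? Obs R)) d
    ...     | inj₁ none = ⊥-elim (never-stuck dr dw more ¬adj
                            (λ u adj-ru → decidable-stable (u ∈? Obs R) (λ u∉ → none u (adj-ru , u∉))))
    ...     | inj₂ (u⁺ , ((e , e∈ , r∈e , u⁺∈e) , u⁺∉) , farthest) =
              d u⁺ , beyond u⁺∉ , advance dr e∈ r∈e u⁺∈e u⁺∉ (λ u adj u∉ → farthest u (adj , u∉)) ◅ ε

    sweep : NeverStuck → ∀ fuel R → n ≤ R + fuel → Star (JointStep H) (Obs R) ⊤
    sweep never-stuck fuel R bound with suc R <? n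
    ... | no done = subst (Star _ (Obs R)) (obs-full (≮⇒≥ done)) ε
    sweep never-stuck zero R bound | yes more =
      ⊥-elim (<-irrefl refl (<-≤-trans (<-trans (n<1+n R) more) (subst (n ≤_) (+-identityʳ R) bound)))
    sweep never-stuck (suc fuel) R bound | yes more with progress never-stuck more
    ... | R′ , R<R′ , steps = steps ◅◅ sweep never-stuck fuel R′
            (≤-trans bound (≤-trans (≤-reflexive (+-suc R fuel)) (+-monoˡ-≤ fuel R<R′)))

    -- An edge leaving the observed region from a vertex within distance R
    -- avoids v, so by convexity it contains r (distance R) and w (distance
    -- R + 1); in particular w is a neighbour of r.
    crossing-edge : ∀ {R r w e x y} → d r ≡ R → d w ≡ suc R → e ∈ₗ edges → x ∈ e → y ∈ e →
                    d x ≤ R → y ∉ Obs R → Adj r w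
    crossing-edge {R} {r} {w} {e} {x} {y} dr dw e∈ x∈e y∈e x-within y∉ =
      e , e∈ , convex e∈ v∉e x∈e w∈e (subst (d x ≤_) (sym dr) x-within) (subst₂ _≤_ (sym dr) (sym dw) (n≤1+n R))
      , w∈e
      where
      v∉e : v ∉ e
      v∉e v∈e = far y∉ (e , e∈ , v∈e , y∈e)
      w∈e : w ∈ e
      w∈e = convex e∈ v∉e x∈e y∈e (subst (d x ≤_) (sym dw) (m≤n⇒m≤1+n x-within))
                                   (subst (_≤ d y) (sym dw) (beyond y∉))

  -- No gap: if all cyclically consecutive vertices are adjacent, the sweep
  -- from any v proceeds, since w follows r and so is its neighbour.
  never-stuck-without-gap : (∀ a c → dist (pos c) (pos a) ≡ n ∸ 1 → Adj a c) → ∀ v → Sweep.NeverStuck v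
  never-stuck-without-gap no-gap v {R} {r} {w} dr dw _ ¬adj all-observed =
    unobserved-next dw ¬adj (all-observed w (no-gap r w (dist-predecessor (<⇒≤ (pos<n v)) (<⇒≤ (pos<n w)) dr dw)))
    where open Sweep v

  -- A gap right before v: if the vertex a preceding v is not adjacent to v,
  -- the sweep from v proceeds. Suppose r has no unobserved neighbour, and
  -- follow a path from v to the unobserved w until it leaves the observed
  -- region, say from x to y along an edge. If x is within distance R, that
  -- edge makes w an unobserved neighbour of r. Otherwise x is a neighbour
  -- of v lying beyond w, and the edge joining v and x skips w, so it wraps
  -- around to a, contradicting the gap.
  never-stuck-after-gap : ∀ {a v} → dist (pos v) (pos a) ≡ n ∸ 1 → ¬ Adj a v → Sweep.NeverStuck v
  never-stuck-after-gap {a} {v} da gap {R} {r} {w} dr dw _ ¬vw all-observed =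
    leave-at (leaves (Obs R) vtx (subst (_∈ Obs R) (sym start) (within (subst (_≤ R) (sym d-self) z≤n)))
                                 (subst (_∉ Obs R) (sym end) (unobserved-next dw ¬vw)))
    where
    open Sweep v
    open Path (connected v w)
    exit : ∀ {f x y} → f ∈ₗ edges → x ∈ f → y ∈ f → x ∈ Obs R → y ∉ Obs R → ⊥
    exit {f} {x} f∈ x∈f y∈f x∈ y∉ with d x ≤? R | Equivalence.to (obs⇔ x) x∈
    ... | yes x-within | _             = unobserved-next dw ¬vw
                                           (all-observed w (crossing-edge dr dw f∈ x∈f y∈f x-within y∉))
    ... | no x-beyond  | inj₁ x-within = x-beyond x-within
    ... | no x-beyond  | inj₂ (g , g∈ , v∈g , x∈g) with d x ≟ suc R | w ∈? g
    ...   | yes dx  | _       = ¬vw (subst (Adj v) (d-injective (trans dx (sym dw))) (g , g∈ , v∈g , x∈g))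
    ...   | no _    | yes w∈g = ¬vw (g , g∈ , v∈g , w∈g)
    ...   | no dx≢  | no w∉g  = gap (g , g∈ , a∈g , v∈g)
      where
      a∈g : a ∈ g
      a∈g = proj₂ (wraps-around g∈ v∈g x∈g w∉g (subst₂ _<_ (sym d-self) (sym dw) (s≤s z≤n))
                     (subst (_< d x) (sym dw) (≤∧≢⇒< (≰⇒> x-beyond) (dx≢ ∘ sym)))) a da
    leave-at : ∃ (λ i → vtx (inject₁ i) ∈ Obs R × vtx (Fin.suc i) ∉ Obs R) → ⊥
    leave-at (i , x∈ , y∉) = exit (edgIn i) (left i) (right i) x∈ y∉

  good-start : Vertex H → ∃ λ v → Sweep.NeverStuck v
  good-start x₀ with any? (λ v → any? (λ a → (dist (pos v) (pos a) ≟ n ∸ 1) ×-dec ¬? (adj? a v)))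
  ... | yes (v , a , da , gap) = v , never-stuck-after-gap da gap
  ... | no no-gap = x₀ , never-stuck-without-gap
                          (λ a c dc → decidable-stable (adj? a c) (λ ¬adj → no-gap (c , a , dc , ¬adj))) x₀

  singleton-observes : Vertex H → ∃ λ v → ∃[ S ] (InitialSet H ⁅ v ⁆ S × Star (JointStep H) S ⊤)
  singleton-observes x₀ with good-start x₀
  ... | v , never-stuck = v , Obs 0 , initially , sweep never-stuck n 0 ≤-refl
    where open Sweep v

some-vertex : (H : Hypergraph) → Vertex H
some-vertex H = proj₁ (Hypergraph.edgeNonempty H (proj₂ (Hypergraph.hasEdge H)))

fin-nonZero : ∀ {m} → Fin m → NonZero m
fin-nonZero {suc _} _ = _

min-size-one : ∀ (H : Hypergraph) {P : VSet H → Set} (v : Vertex H) → P ⁅ v ⁆ →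
               (∀ S₀ → P S₀ → 1 ≤ ∣ S₀ ∣) → IsMinSize H P 1
min-size-one H v p lower = (⁅ v ⁆ , p , ∣⁅x⁆∣≡1 v) , lower

proposition5p3 : (H : Hypergraph) → Connected H → IsCircularArcInterval H →
    InfectiousPowerDominationNumber H 1 × PowerDominationNumber H 1
proposition5p3 H connected circular
  with x₀ ← some-vertex H
  with v , S , initial , steps ← CircularArc.singleton-observes H connected circular {{fin-nonZero x₀}} x₀ =
    min-size-one H v (S , initial , Star.map proj₂ steps)
                 (initial-nonempty H x₀ λ (_ , _ , (u , u∈A) , A⊆S , _) → u , A⊆S u∈A)
  , min-size-one H v (S , initial , Star.map proj₁ steps)
                 (initial-nonempty H x₀ λ (u , _ , u∈S , _) → u , u∈S)
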